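{- Let $G$ be a disconnected finite simple graph such that both $G$ and $\overline{G}$ are distance-hereditary. Then each connected component of $G$ is a cograph, and hence $G$ is a cograph.
   Context: A graph is distance-hereditary if it contains no induced hole (cycle of length at least $5$), house ($4$-cycle plus a vertex adjacent to exactly two adjacent vertices of the cycle), domino (two $4$-cycles sharing an edge), or gem ($P_4$ plus a vertex adjacent to all its vertices). A cograph is a graph with no induced $P_4$. -}

module Defs where

open import Data.Nat using (ℕ; zero; suc; _∸_; _≡ᵇ_; _≤_)
open import Data.Fin using (Fin; toℕ; _≟_)
open import Data.Bool using (Bool; true; false; not; _∧_; _∨_; if_then_else_)
open import Data.List using (List)
open import Data.Bool.ListAction using (any)
open import Data.Product using (Σ; _×_; _,_; ∃)
open import Relation.Binary.PropositionalEquality using (_≡_; _≢_; refl; sym)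
open import Relation.Nullary using (¬_; yes; no)
open import Function.Definitions using (Injective)

record Graph (n : ℕ) : Set where
  field
    adj    : Fin n → Fin n → Bool
    adj-sym : ∀ i j → adj i j ≡ adj j i
    adj-irr : ∀ i → adj i i ≡ false
open Graph public

compAdj : ∀ {n} → Graph n → Fin n → Fin n → Bool
compAdj G i j with i ≟ j
... | yes _ = false
... | no  _ = not (adj G i j)

private
  compSym : ∀ {n} (G : Graph n) i j → compAdj G i j ≡ compAdj G j i
  compSym G i j with i ≟ j | j ≟ i
  ... | yes _ | yes _ = refl
  ... | yes p | no q = Data.Empty.⊥-elim (q (sym p))
    where import Data.Empty
  ... | no q | yes p = Data.Empty.⊥-elim (q (sym p))
    where import Data.Empty
  ... | no _ | no _ rewrite adj-sym G i j = refl

  compIrr : ∀ {n} (G : Graph n) i → compAdj G i i ≡ false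
  compIrr G i with i ≟ i
  ... | yes _ = refl
  ... | no q = Data.Empty.⊥-elim (q refl)
    where import Data.Empty

complement : ∀ {n} → Graph n → Graph n
complement G = record { adj = compAdj G ; adj-sym = compSym G ; adj-irr = compIrr G }

-- Pattern graphs, given by adjacency functions on Fin k
-- (only values on distinct vertices matter).
Pattern : ℕ → Set
Pattern k = Fin k → Fin k → Bool

fromEdges : ∀ {k} → List (ℕ × ℕ) → Pattern k
fromEdges es i j = any (λ { (a , b) → ((a ≡ᵇ toℕ i) ∧ (b ≡ᵇ toℕ j)) ∨ ((a ≡ᵇ toℕ j) ∧ (b ≡ᵇ toℕ i)) }) es

open Data.List using ([]; _∷_)

P4 : Pattern 4
P4 = fromEdges ((0 , 1) ∷ (1 , 2) ∷ (2 , 3) ∷ [])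

House : Pattern 5
House = fromEdges ((0 , 1) ∷ (1 , 2) ∷ (2 , 3) ∷ (3 , 0) ∷ (4 , 0) ∷ (4 , 1) ∷ [])

Domino : Pattern 6
Domino = fromEdges ((0 , 1) ∷ (1 , 2) ∷ (2 , 3) ∷ (3 , 4) ∷ (4 , 5) ∷ (5 , 0) ∷ (1 , 4) ∷ [])

Gem : Pattern 5
Gem = fromEdges ((0 , 1) ∷ (1 , 2) ∷ (2 , 3) ∷ (4 , 0) ∷ (4 , 1) ∷ (4 , 2) ∷ (4 , 3) ∷ [])

Cycle : (k : ℕ) → Pattern k
Cycle k i j =
  (suc (toℕ i) ≡ᵇ toℕ j) ∨ (suc (toℕ j) ≡ᵇ toℕ i)
  ∨ ((toℕ i ≡ᵇ 0) ∧ (toℕ j ≡ᵇ (k ∸ 1)))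
  ∨ ((toℕ j ≡ᵇ 0) ∧ (toℕ i ≡ᵇ (k ∸ 1)))

IsInducedCopy : ∀ {n k} → Graph n → Pattern k → (Fin k → Fin n) → Set
IsInducedCopy G H f = Injective _≡_ _≡_ f × (∀ i j → i ≢ j → adj G (f i) (f j) ≡ H i j)

HasInduced : ∀ {n k} → Graph n → Pattern k → Set
HasInduced {k = k} G H = Σ (Fin k → _) λ f → IsInducedCopy G H f

data Reach {n} (G : Graph n) : Fin n → Fin n → Set where
  here : ∀ {u} → Reach G u u
  step : ∀ {u w v} → adj G u w ≡ true → Reach G w v → Reach G u v

Connected : ∀ {n} → Graph n → Set
Connected G = ∀ u v → Reach G u v

Disconnected : ∀ {n} → Graph n → Set
Disconnected G = ¬ Connected G

DistanceHereditary : ∀ {n} → Graph n → Set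
DistanceHereditary G =
  (∀ k → 5 ≤ k → ¬ HasInduced G (Cycle k))
  × ¬ HasInduced G House
  × ¬ HasInduced G Domino
  × ¬ HasInduced G Gem

Cograph : ∀ {n} → Graph n → Set
Cograph G = ¬ HasInduced G P4

-- The connected component of G containing v is a cograph: the induced
-- subgraph on the vertices reachable from v has no induced P4, i.e. there
-- is no induced P4 in G all of whose vertices lie in that component.
ComponentCograph : ∀ {n} → Graph n → Fin n → Set
ComponentCograph G v =
  ¬ (Σ (Fin 4 → _) λ f → IsInducedCopy G P4 f × (∀ i → Reach G v (f i)))

{-# OPTIONS --safe #-}
module Submission where

-- P4 is self-complementary: if f is an induced path a-b-c-d of G, then c-a-d-b is an induced
-- path of the complement. A vertex of G with no neighbour on a-b-c-d is adjacent in the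
-- complement to all of c-a-d-b, so together they form a gem. Hence, when the complement is
-- gem-free, every vertex of G has a neighbour on each induced P4 of G, and G is connected.
-- A disconnected G with gem-free complement therefore has no induced P4 at all.

open import Defs
open import Data.Nat using (ℕ; suc)
open import Data.Fin using (Fin; zero; suc; _≟_; #_)
open import Data.Fin.Properties using (all?; any?)
open import Data.Bool using (true; false; not)
open import Data.Bool.Properties using (not-¬; ¬-not) renaming (_≟_ to _≟ᵇ_)
open import Data.Vec using ([]; _∷_; lookup)
open import Data.Vec.Functional using () renaming (_∷_ to _◃_)
open import Data.Product using (_×_; _,_; ∃-syntax)
open import Data.Empty using (⊥-elim)
open import Function using (_∘_)
open import Function.Definitions using (Injective)
open import Relation.Nullary using (¬_; yes; no; ¬?)
open import Relation.Nullary.Decidable using (from-yes; _→-dec_; _×-dec_)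
open import Relation.Binary.PropositionalEquality using (_≡_; _≢_; refl; sym; trans; cong)

private
  variable
    n k l : ℕ

compAdj-≢ : (G : Graph n) {u v : Fin n} → u ≢ v → compAdj G u v ≡ not (adj G u v)
compAdj-≢ G {u} {v} u≢v with u ≟ v
... | yes u≡v = ⊥-elim (u≢v u≡v)
... | no _    = refl

adj⇒≢ : (G : Graph n) {u v : Fin n} → adj G u v ≡ true → u ≢ v
adj⇒≢ G {u} uv refl = not-¬ (adj-irr G u) uv

reach-snoc : {G : Graph n} {u w v : Fin n} → Reach G u w → adj G w v ≡ true → Reach G u v
reach-snoc here       wv = step wv here
reach-snoc (step e r) wv = step e (reach-snoc r wv)

reach-sym : {G : Graph n} {u v : Fin n} → Reach G u v → Reach G v u
reach-sym         here                   = here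
reach-sym {G = G} (step {u} {w} uw r) = reach-snoc (reach-sym r) (trans (adj-sym G w u) uw)

reach-trans : {G : Graph n} {u w v : Fin n} → Reach G u w → Reach G w v → Reach G u v
reach-trans here       r′ = r′
reach-trans (step e r) r′ = step e (reach-trans r r′)

connected-if-all-reach : (G : Graph n) (c : Fin n) → (∀ u → Reach G u c) → Connected G
connected-if-all-reach G c reach u v = reach-trans (reach u) (reach-sym (reach v))

complementPattern : Pattern k → Pattern k
complementPattern P i j = not (P i j)

Cone : Pattern k → Pattern (suc k)
Cone P zero    zero    = false
Cone P zero    (suc _) = true
Cone P (suc _) zero    = true
Cone P (suc i) (suc j) = P i j

complement-copy : (G : Graph n) {P : Pattern k} {f : Fin k → Fin n} →
  IsInducedCopy G P f → IsInducedCopy (complement G) (complementPattern P) f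
complement-copy G (f-inj , f-adj) = f-inj , λ i j i≢j →
  trans (compAdj-≢ G (i≢j ∘ f-inj)) (cong not (f-adj i j i≢j))

cone-copy : (G : Graph n) {P : Pattern k} {f : Fin k → Fin n} (x : Fin n) →
  IsInducedCopy G P f → (∀ i → adj G x (f i) ≡ true) → IsInducedCopy G (Cone P) (x ◃ f)
cone-copy G {P} {f} x (f-inj , f-adj) x-dom = inj , adj-cone
  where
  inj : Injective _≡_ _≡_ (x ◃ f)
  inj {zero}  {zero}  _  = refl
  inj {zero}  {suc j} eq = ⊥-elim (adj⇒≢ G (x-dom j) eq)
  inj {suc i} {zero}  eq = ⊥-elim (adj⇒≢ G (x-dom i) (sym eq))
  inj {suc i} {suc j} eq = cong suc (f-inj eq)

  adj-cone : ∀ i j → i ≢ j → adj G ((x ◃ f) i) ((x ◃ f) j) ≡ Cone P i j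
  adj-cone zero    zero    i≢j = ⊥-elim (i≢j refl)
  adj-cone zero    (suc j) _   = x-dom j
  adj-cone (suc i) zero    _   = trans (adj-sym G (f i) x) (x-dom i)
  adj-cone (suc i) (suc j) i≢j = f-adj i j (i≢j ∘ cong suc)

relabel-copy : (G : Graph n) {P : Pattern k} {Q : Pattern l} {f : Fin l → Fin n} (π : Fin k → Fin l) →
  Injective _≡_ _≡_ π → (∀ i j → i ≢ j → Q (π i) (π j) ≡ P i j) →
  IsInducedCopy G Q f → IsInducedCopy G P (f ∘ π)
relabel-copy G π π-inj π-adj (f-inj , f-adj) =
  π-inj ∘ f-inj , λ i j i≢j → trans (f-adj (π i) (π j) (i≢j ∘ π-inj)) (π-adj i j i≢j)

-- The gem's apex 4 goes to the cone's apex 0, and its path 0-1-2-3 to the complementary path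
-- 2-0-3-1 of P4, shifted by one past the apex.
gemLabel : Fin 5 → Fin 5
gemLabel = lookup (# 3 ∷ # 1 ∷ # 4 ∷ # 2 ∷ # 0 ∷ [])

gemLabel-injective : Injective _≡_ _≡_ gemLabel
gemLabel-injective {i} {j} =
  from-yes (all? λ i → all? λ j → (gemLabel i ≟ gemLabel j) →-dec (i ≟ j)) i j

gemLabel-adj : ∀ i j → i ≢ j → Cone (complementPattern P4) (gemLabel i) (gemLabel j) ≡ Gem i j
gemLabel-adj = from-yes (all? λ i → all? λ j →
  ¬? (i ≟ j) →-dec (Cone (complementPattern P4) (gemLabel i) (gemLabel j) ≟ᵇ Gem i j))

P4-has-no-isolated-vertex : ∀ i → ∃[ j ] i ≢ j × P4 i j ≡ true
P4-has-no-isolated-vertex =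
  from-yes (all? λ i → any? λ j → ¬? (i ≟ j) ×-dec (P4 i j ≟ᵇ true))

non-neighbour-outside-copy : (G : Graph n) {P : Pattern k} {f : Fin k → Fin n} {x : Fin n} →
  IsInducedCopy G P f → (∀ i → ∃[ j ] i ≢ j × P i j ≡ true) →
  (∀ i → adj G x (f i) ≡ false) → ∀ i → x ≢ f i
non-neighbour-outside-copy G (_ , f-adj) no-isolated x-far i refl
  with j , i≢j , Pij ← no-isolated i = not-¬ (x-far j) (trans (f-adj i j i≢j) Pij)

gem-from-P4-and-non-neighbour : (G : Graph n) {f : Fin 4 → Fin n} (x : Fin n) →
  IsInducedCopy G P4 f → (∀ i → adj G x (f i) ≡ false) → HasInduced (complement G) Gem
gem-from-P4-and-non-neighbour G {f} x f-P4 x-far =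
  (x ◃ f) ∘ gemLabel ,
  relabel-copy (complement G) gemLabel gemLabel-injective gemLabel-adj
    (cone-copy (complement G) x (complement-copy G f-P4) x-dom)
  where
  x-dom : ∀ i → compAdj G x (f i) ≡ true
  x-dom i = trans (compAdj-≢ G (non-neighbour-outside-copy G f-P4 P4-has-no-isolated-vertex x-far i))
                  (cong not (x-far i))

P4-copy-reaches-start : (G : Graph n) {f : Fin 4 → Fin n} → IsInducedCopy G P4 f → ∀ i → Reach G (f i) (f zero)
P4-copy-reaches-start G {f} (_ , f-adj) = reach
  where
  edge : ∀ i j → P4 i j ≡ true → i ≢ j → adj G (f i) (f j) ≡ true
  edge i j Pij i≢j = trans (f-adj i j i≢j) Pij

  from₁ : Reach G (f (# 1)) (f zero)
  from₁ = step (edge (# 1) (# 0) refl λ ()) here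

  from₂ : Reach G (f (# 2)) (f zero)
  from₂ = step (edge (# 2) (# 1) refl λ ()) from₁

  reach : ∀ i → Reach G (f i) (f zero)
  reach zero                   = here
  reach (suc zero)             = from₁
  reach (suc (suc zero))       = from₂
  reach (suc (suc (suc zero))) = step (edge (# 3) (# 2) refl λ ()) from₂

neighbour-on-P4 : (G : Graph n) {f : Fin 4 → Fin n} → ¬ HasInduced (complement G) Gem →
  IsInducedCopy G P4 f → ∀ x → ∃[ i ] adj G x (f i) ≡ true
neighbour-on-P4 G {f} gem-free f-P4 x with any? (λ i → adj G x (f i) ≟ᵇ true)
... | yes neighbour  = neighbour
... | no no-neighbour =
  ⊥-elim (gem-free (gem-from-P4-and-non-neighbour G x f-P4 λ i → ¬-not (no-neighbour ∘ (i ,_))))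

connected-if-complement-gem-free : (G : Graph n) → ¬ HasInduced (complement G) Gem →
  HasInduced G P4 → Connected G
connected-if-complement-gem-free G gem-free (f , f-P4) = connected-if-all-reach G (f zero) reach-start
  where
  reach-start : ∀ u → Reach G u (f zero)
  reach-start u with i , ui ← neighbour-on-P4 G gem-free f-P4 u = step ui (P4-copy-reaches-start G f-P4 i)

mainTheorem8 : ∀ {n} (G : Graph n) → Disconnected G → DistanceHereditary G → DistanceHereditary (complement G)
    → (∀ (v : Fin n) → ComponentCograph G v) × Cograph G
mainTheorem8 G disconnected _ (_ , _ , _ , complement-gem-free) = cograph-component , cograph
  where
  cograph : Cograph G
  cograph P4-copy = disconnected (connected-if-complement-gem-free G complement-gem-free P4-copy)

  cograph-component : ∀ v → ComponentCograph G v
  cograph-component _ (f , f-P4 , _) = cograph (f , f-P4)
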